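{- Let $q>1$ and $n\ge 2$, and let $S$ be an $n$-window sequence over $\mathbb{Z}_q$ with the property that every $n$-tuple $\mathbf{s}_n(i)$ appearing in $S$ has pseudoweight less than $nq/2$. Then $S$ is a negative orientable sequence of order $n$.
   Context: Sequences are periodic with entries in $\mathbb{Z}_q$. For $S=(s_i)$ write $\mathbf{s}_n(i)=(s_i,\ldots,s_{i+n-1})$; for an $n$-tuple $\mathbf{u}=(u_0,\ldots,u_{n-1})$ let $\mathbf{u}^R=(u_{n-1},\ldots,u_0)$ and $-\mathbf{u}=(-u_0,\ldots,-u_{n-1})$. A periodic sequence of period $m$ is an $n$-window sequence if $\mathbf{s}_n(i)=\mathbf{s}_n(j)$ implies $i\equiv j\pmod m$; it is a negative orientable sequence of order $n$ if also $\mathbf{s}_n(i)\neq-\mathbf{s}_n(j)^R$ for all $i,j$. Pseudoweight: define $f:\mathbb{Z}_q\to\mathbb{Q}$ by treating $u$ as an integer in $[0,q-1]$, $f(u)=u$ if $u\neq0$ and $f(0)=q/2$; the pseudoweight of $(u_0,\ldots,u_{n-1})$ is $\sum_i f(u_i)$ computed in $\mathbb{Q}$. -}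

module Defs where

open import Data.Nat as ℕ using (ℕ; zero; suc; NonZero; _∸_)
open import Data.Nat.DivMod using (_mod_)
open import Data.Fin as Fin using (Fin; toℕ)
open import Data.Vec as Vec using (Vec; tabulate; reverse; map; foldr′)
open import Data.Integer as ℤ using (+_)
open import Data.Rational as ℚ using (ℚ; 0ℚ; _+_; _/_; _<_)
open import Data.Product using (_×_)
open import Relation.Binary.PropositionalEquality using (_≡_; _≢_)

IsPeriodic : {q : ℕ} → (m : ℕ) → (ℕ → Fin q) → Set
IsPeriodic m s = ∀ i → s (i ℕ.+ m) ≡ s i

window : {q : ℕ} → (n : ℕ) → (ℕ → Fin q) → ℕ → Vec (Fin q) n
window n s i = tabulate (λ k → s (i ℕ.+ toℕ k))

negℤq : {q : ℕ} .{{_ : NonZero q}} → Fin q → Fin q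
negℤq {q} u = (q ∸ toℕ u) mod q

negTuple : {q n : ℕ} .{{_ : NonZero q}} → Vec (Fin q) n → Vec (Fin q) n
negTuple = map negℤq

IsWindowSeq : {q : ℕ} → (n m : ℕ) .{{_ : NonZero m}} → (ℕ → Fin q) → Set
IsWindowSeq n m s = ∀ i j → window n s i ≡ window n s j → i mod m ≡ j mod m

IsNegOrientable : {q : ℕ} .{{_ : NonZero q}} → (n m : ℕ) .{{_ : NonZero m}} → (ℕ → Fin q) → Set
IsNegOrientable n m s =
  IsWindowSeq n m s × (∀ i j → window n s i ≢ negTuple (reverse (window n s j)))

pwf : {q : ℕ} → Fin q → ℚ
pwf {q} Fin.zero = (+ q) / 2
pwf (Fin.suc k) = (+ toℕ (Fin.suc k)) / 1

pseudoweight : {q n : ℕ} → Vec (Fin q) n → ℚ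
pseudoweight v = foldr′ _+_ 0ℚ (map pwf v)

{-# OPTIONS --safe #-}
module Submission where

-- Twice the weight f is a natural number: 2f(u) = 2u for u ≠ 0 and 2f(0) = q.
-- Since f(−u) + f(u) = q for every u ∈ ℤ_q, the pseudoweights of a tuple and of
-- its negated reversal add up to exactly nq.  If some window equalled the negated
-- reversal of another, the two pseudoweights would be below nq/2 and yet sum to nq.

open import Defs
open import Data.Nat as ℕ using (ℕ; NonZero; _≤_; _*_; zero; suc; _+_; _∸_; z<s; >-nonZero)
open import Data.Fin as Fin using (Fin; toℕ)
open import Data.Integer using (+_)
open import Data.Rational using (_/_; _<_)

open import Data.Nat.Properties
  using (+-identityʳ; *-identityˡ; +-assoc; +-comm; *-distribˡ-+; <-irrefl; <⇒≤; +-mono-<;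
         ∸-monoʳ-<; m<n⇒0<n∸m; m∸n+n≡m; +-commutativeSemigroup)
open import Algebra.Properties.CommutativeSemigroup +-commutativeSemigroup using (interchange)
open import Data.Nat.DivMod using (_%_; m%n<n; n%n≡0; m<n⇒m%n≡m)
open import Data.Fin.Properties using (toℕ-fromℕ<; toℕ<n)
import Data.Integer as ℤ
open import Data.Integer.Properties using (*-cancelʳ-<-nonNeg; drop‿+<+)
import Data.Integer.Tactic.RingSolver as ℤ-Solver
open import Data.Rational as ℚ using (toℚᵘ)
open import Data.Rational.Properties
  using (toℚᵘ-injective; toℚᵘ-fromℚᵘ; toℚᵘ-homo-+; toℚᵘ-mono-<)
import Data.Rational.Unnormalised as ℚᵘ
import Data.Rational.Unnormalised.Properties as ℚᵘ
open import Data.Vec using (Vec; []; _∷_; _∷ʳ_; map; reverse; sum)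
open import Data.Vec.Properties using (reverse-∷; map-reverse)
open import Data.Product using (_,_)
open import Relation.Binary.PropositionalEquality
  using (_≡_; _≢_; refl; sym; trans; cong; cong₂; subst; module ≡-Reasoning)

toℚᵘ-/ : ∀ i d → toℚᵘ (i / suc d) ℚᵘ.≃ (i ℚᵘ./ suc d)
toℚᵘ-/ i d = toℚᵘ-fromℚᵘ (i ℚᵘ./ suc d)

/-homo-+ : ∀ i j d → (i ℤ.+ j) / suc d ≡ i / suc d ℚ.+ j / suc d
/-homo-+ i j d = toℚᵘ-injective (begin
  toℚᵘ ((i ℤ.+ j) / suc d)                 ≈⟨ toℚᵘ-/ (i ℤ.+ j) d ⟩
  (i ℤ.+ j) ℚᵘ./ suc d                      ≈⟨ ℚᵘ.*≡* (cross i j (+ suc d)) ⟩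
  i ℚᵘ./ suc d ℚᵘ.+ j ℚᵘ./ suc d            ≈⟨ ℚᵘ.+-cong (toℚᵘ-/ i d) (toℚᵘ-/ j d) ⟨
  toℚᵘ (i / suc d) ℚᵘ.+ toℚᵘ (j / suc d)   ≈⟨ toℚᵘ-homo-+ (i / suc d) (j / suc d) ⟨
  toℚᵘ (i / suc d ℚ.+ j / suc d)           ∎)
  where
  open ℚᵘ.≃-Reasoning
  cross : ∀ i j d → (i ℤ.+ j) ℤ.* (d ℤ.* d) ≡ (i ℤ.* d ℤ.+ j ℤ.* d) ℤ.* d
  cross = ℤ-Solver.solve-∀

/-cancel-< : ∀ {i j} d → i / suc d < j / suc d → i ℤ.< j
/-cancel-< {i} {j} d i/d<j/d
  with ℚᵘ.<-respʳ-≃ (toℚᵘ-/ j d) (ℚᵘ.<-respˡ-≃ (toℚᵘ-/ i d) (toℚᵘ-mono-< i/d<j/d))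
... | ℚᵘ.*<* i*d<j*d = *-cancelʳ-<-nonNeg (+ suc d) i*d<j*d

*-cancelˡ-/ : ∀ k i d → (+ suc k ℤ.* i) / (suc k * suc d) ≡ i / suc d
*-cancelˡ-/ k i d = toℚᵘ-injective (begin
  toℚᵘ ((+ suc k ℤ.* i) / (suc k * suc d))  ≈⟨ toℚᵘ-/ (+ suc k ℤ.* i) (d + k * suc d) ⟩
  (+ suc k ℤ.* i) ℚᵘ./ (suc k * suc d)       ≈⟨ ℚᵘ.*-cancelˡ-/ (suc k) ⟩
  i ℚᵘ./ suc d                               ≈⟨ toℚᵘ-/ i d ⟨
  toℚᵘ (i / suc d)                           ∎)
  where open ℚᵘ.≃-Reasoning

sum-∷ʳ : ∀ {n} (xs : Vec ℕ n) x → sum (xs ∷ʳ x) ≡ sum xs + x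
sum-∷ʳ []       x = +-identityʳ x
sum-∷ʳ (y ∷ ys) x = begin
  y + sum (ys ∷ʳ x) ≡⟨ cong (_+_ y) (sum-∷ʳ ys x) ⟩
  y + (sum ys + x)  ≡⟨ +-assoc y (sum ys) x ⟨
  y + sum ys + x    ∎
  where open ≡-Reasoning

sum-reverse : ∀ {n} (xs : Vec ℕ n) → sum (reverse xs) ≡ sum xs
sum-reverse []       = refl
sum-reverse (x ∷ xs) = begin
  sum (reverse (x ∷ xs))  ≡⟨ cong sum (reverse-∷ x xs) ⟩
  sum (reverse xs ∷ʳ x)   ≡⟨ sum-∷ʳ (reverse xs) x ⟩
  sum (reverse xs) + x    ≡⟨ cong (_+ x) (sum-reverse xs) ⟩
  sum xs + x              ≡⟨ +-comm (sum xs) x ⟩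
  x + sum xs              ∎
  where open ≡-Reasoning

doubledWeight : ℕ → ℕ → ℕ
doubledWeight q zero      = q
doubledWeight q k@(suc _) = 2 * k

doubledWeight-nonZero : ∀ q k .{{_ : NonZero k}} → doubledWeight q k ≡ 2 * k
doubledWeight-nonZero q (suc k) = refl

doubledWeight-complement : ∀ q .{{_ : NonZero q}} t → t ℕ.< q →
  doubledWeight q ((q ∸ t) % q) + doubledWeight q t ≡ 2 * q
doubledWeight-complement q zero    _   = begin
  doubledWeight q (q % q) + q ≡⟨ cong (λ r → doubledWeight q r + q) (n%n≡0 q) ⟩
  q + q                       ≡⟨ cong (_+_ q) (*-identityˡ q) ⟨
  2 * q                       ∎
  where open ≡-Reasoning
doubledWeight-complement q t@(suc _) t<q = begin
  doubledWeight q ((q ∸ t) % q) + 2 * t ≡⟨ cong (λ r → doubledWeight q r + 2 * t) (m<n⇒m%n≡m q∸t<q) ⟩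
  doubledWeight q (q ∸ t) + 2 * t       ≡⟨ cong (_+ 2 * t) (doubledWeight-nonZero q (q ∸ t) {{>-nonZero (m<n⇒0<n∸m t<q)}}) ⟩
  2 * (q ∸ t) + 2 * t                   ≡⟨ *-distribˡ-+ 2 (q ∸ t) t ⟨
  2 * (q ∸ t + t)                       ≡⟨ cong (2 *_) (m∸n+n≡m (<⇒≤ t<q)) ⟩
  2 * q                                 ∎
  where
  open ≡-Reasoning
  q∸t<q : q ∸ t ℕ.< q
  q∸t<q = ∸-monoʳ-< {m = q} z<s (<⇒≤ t<q)

doubledWeight-negℤq : ∀ {q} .{{_ : NonZero q}} (u : Fin q) →
  doubledWeight q (toℕ (negℤq u)) + doubledWeight q (toℕ u) ≡ 2 * q
doubledWeight-negℤq {q} u = trans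
  (cong (λ r → doubledWeight q r + doubledWeight q (toℕ u)) (toℕ-fromℕ< (m%n<n (q ∸ toℕ u) q)))
  (doubledWeight-complement q (toℕ u) (toℕ<n u))

doubledPseudoweight : ∀ {q n} → Vec (Fin q) n → ℕ
doubledPseudoweight {q} v = sum (map (λ u → doubledWeight q (toℕ u)) v)

pwf≡doubledWeight/2 : ∀ {q} (u : Fin q) → pwf u ≡ + doubledWeight q (toℕ u) / 2
pwf≡doubledWeight/2 Fin.zero    = refl
pwf≡doubledWeight/2 (Fin.suc k) = sym (*-cancelˡ-/ 1 (+ suc (toℕ k)) 0)

pseudoweight≡doubledPseudoweight/2 : ∀ {q n} (v : Vec (Fin q) n) →
  pseudoweight v ≡ + doubledPseudoweight v / 2
pseudoweight≡doubledPseudoweight/2 []       = refl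
pseudoweight≡doubledPseudoweight/2 {q} (u ∷ v) = begin
  pwf u ℚ.+ pseudoweight v
    ≡⟨ cong₂ ℚ._+_ (pwf≡doubledWeight/2 u) (pseudoweight≡doubledPseudoweight/2 v) ⟩
  + doubledWeight q (toℕ u) / 2 ℚ.+ + doubledPseudoweight v / 2
    ≡⟨ /-homo-+ (+ doubledWeight q (toℕ u)) (+ doubledPseudoweight v) 1 ⟨
  + doubledPseudoweight (u ∷ v) / 2
    ∎
  where open ≡-Reasoning

pseudoweight<⇒doubledPseudoweight< : ∀ {q n} (v : Vec (Fin q) n) c →
  pseudoweight v < + c / 2 → doubledPseudoweight v ℕ.< c
pseudoweight<⇒doubledPseudoweight< v c pw<c/2 =
  drop‿+<+ (/-cancel-< 1 (subst (_< + c / 2) (pseudoweight≡doubledPseudoweight/2 v) pw<c/2))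

doubledPseudoweight-reverse : ∀ {q n} (v : Vec (Fin q) n) →
  doubledPseudoweight (reverse v) ≡ doubledPseudoweight v
doubledPseudoweight-reverse {q} v = trans
  (cong sum (map-reverse (λ u → doubledWeight q (toℕ u)) v))
  (sum-reverse (map (λ u → doubledWeight q (toℕ u)) v))

doubledPseudoweight-negTuple : ∀ {q n} .{{_ : NonZero q}} (v : Vec (Fin q) n) →
  doubledPseudoweight (negTuple v) + doubledPseudoweight v ≡ n * (2 * q)
doubledPseudoweight-negTuple []      = refl
doubledPseudoweight-negTuple {q} {suc n} (u ∷ v) = begin
  (w (negℤq u) + doubledPseudoweight (negTuple v)) + (w u + doubledPseudoweight v)
    ≡⟨ interchange (w (negℤq u)) (doubledPseudoweight (negTuple v)) (w u) (doubledPseudoweight v) ⟩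
  (w (negℤq u) + w u) + (doubledPseudoweight (negTuple v) + doubledPseudoweight v)
    ≡⟨ cong₂ _+_ (doubledWeight-negℤq u) (doubledPseudoweight-negTuple v) ⟩
  2 * q + n * (2 * q)
    ∎
  where
  open ≡-Reasoning
  w : Fin q → ℕ
  w u = doubledWeight q (toℕ u)

theorem2 : (q n m : ℕ) → .{{_ : NonZero q}} → .{{_ : NonZero m}} →
    2 ≤ q → 2 ≤ n →
    (s : ℕ → Fin q) → IsPeriodic m s → IsWindowSeq n m s →
    (∀ i → pseudoweight (window n s i) < (+ (n * q)) / 2) →
    IsNegOrientable n m s
theorem2 q n m _ _ s _ isWindowSeq light = isWindowSeq , noNegatedReversal
  where
  open ≡-Reasoning
  doubledLight : ∀ i → doubledPseudoweight (window n s i) ℕ.< n * q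
  doubledLight i = pseudoweight<⇒doubledPseudoweight< (window n s i) (n * q) (light i)

  noNegatedReversal : ∀ i j → window n s i ≢ negTuple (reverse (window n s j))
  noNegatedReversal i j wᵢ≡-wⱼᴿ = <-irrefl complementary (+-mono-< (doubledLight i) (doubledLight j))
    where
    wⱼ : Vec (Fin q) n
    wⱼ = window n s j
    complementary : doubledPseudoweight (window n s i) + doubledPseudoweight wⱼ ≡ n * q + n * q
    complementary = begin
      doubledPseudoweight (window n s i) + doubledPseudoweight wⱼ
        ≡⟨ cong₂ _+_ (cong doubledPseudoweight wᵢ≡-wⱼᴿ) (sym (doubledPseudoweight-reverse wⱼ)) ⟩
      doubledPseudoweight (negTuple (reverse wⱼ)) + doubledPseudoweight (reverse wⱼ)
        ≡⟨ doubledPseudoweight-negTuple (reverse wⱼ) ⟩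
      n * (2 * q)
        ≡⟨ *-distribˡ-+ n q (1 * q) ⟩
      n * q + n * (1 * q)
        ≡⟨ cong (λ r → n * q + n * r) (*-identityˡ q) ⟩
      n * q + n * q
        ∎
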